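{- Let $t$ be a sufficiently large integer and $0<\beta<1$. Let $\rho>0$ be sufficiently small in terms of $\beta$, and let $C$ be sufficiently large in terms of $t$, $\beta^{ -1}$ and $\rho^{ -1}$. Let $n$ be large enough with $C(C-1)$ dividing $n-1$, and consider the blocks of $S(2,C,n)$. Suppose each block $B$ has an associated set $B_0\subseteq B$ with $|B_0|=(1-\rho)C$. Then for any equipartition of $[n]$ into sets $V_1,\dots,V_t$, there is a collection $\mathcal B$ containing at least a $(1-\beta)$-fraction of the blocks of $S(2,C,n)$ such that for each $B\in\mathcal B$, at least $(1-\beta)t$ of the sets $V_i$ satisfy $|B_0\cap V_i|\ge\frac{C}{200t}$.
   Context: $S(2,C,n)$ is a fixed partition of the edge set of the complete graph $K_n$ on $[n]$ into edge sets of cliques on $C$ vertices (blocks); a block is identified with its vertex set. An equipartition of a set into $V_1,\dots,V_t$ is a partition with $||V_i|-|V_j||\le1$ for all $i,j$. -}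

module Defs where

open import Data.Nat using (ℕ; suc; _+_; _≤_)
open import Data.Fin using (Fin)
open import Data.Fin.Subset using (Subset; _∈_; ∣_∣; _∩_)
open import Data.Vec using (tabulate)
open import Data.Bool using (Bool)
open import Data.Product using (_×_; Σ)
open import Relation.Binary.PropositionalEquality using (_≡_; _≢_)
open import Relation.Nullary.Decidable using (⌊_⌋)
open import Data.Integer using (+_)
open import Data.Rational using (ℚ; _/_)
import Data.Fin as F

ℕ→ℚ : ℕ → ℚ
ℕ→ℚ k = + k / 1

record SteinerSystem (C n m : ℕ) : Set where
  field
    block      : Fin m → Subset n
    block-size : ∀ j → ∣ block j ∣ ≡ C
    cover      : ∀ u v → u ≢ v → Σ (Fin m) λ j → u ∈ block j × v ∈ block j
    unique     : ∀ u v → u ≢ v → ∀ j k →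
                 u ∈ block j → v ∈ block j → u ∈ block k → v ∈ block k → j ≡ k

cls : ∀ {n t} → (Fin n → Fin t) → Fin t → Subset n
cls part i = tabulate (λ v → ⌊ part v F.≟ i ⌋)

IsEquipartition : ∀ {n t} → (Fin n → Fin t) → Set
IsEquipartition {t = t} part = ∀ i j → ∣ cls part i ∣ ≤ suc ∣ cls part j ∣

module Submission where

{-
Let K = 1 + k with K β ≥ 1, and take ρ ≤ 1 / (400 K) and C ≥ 16 K² t.

Fix a class V, of size s with n ≤ 2 t s, and put x_B = |B ∩ V|.  Counting ordered pairs of
distinct points inside blocks gives Σ x_B (x_B - 1) = s (s - 1), (C - 1) Σ x_B = s (n - 1) and
m C (C - 1) = n (n - 1).  So x_B has mean s C / n and (C - 1) Σ (n x_B - s C)² ≤ n² s (n - 1);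
by Chebyshev at most m / (2 K²) blocks are low for V, i.e. have 100 t x_B < C.  Summing over
the t classes, at most m / K blocks are low for more than t / (2 K) classes; ℬ is the rest.

Inside a block B of ℬ, a class V with 200 t |B₀ ∩ V| < C is either low for B or has
200 t |(B ∖ B₀) ∩ V| ≥ C.  Since |B ∖ B₀| = ρ C ≤ C / (400 K), at most t / (2 K) classes are of
the second kind, so at most t / K ≤ β t classes are bad for B.
-}

open import Data.Bool using (Bool; true; false; not; _∧_)
open import Data.Bool.Properties using (∧-zeroʳ; ∧-identityʳ; ∧-conicalˡ; ∧-conicalʳ; ¬-not)
open import Data.Fin using (Fin; zero; suc; _≟_)
open import Data.Fin.Properties using (suc-injective)
open import Data.Fin.Subset using (Subset; _∈_; _⊆_; ∣_∣; _∩_)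
open import Data.Fin.Subset.Properties using (p⊆q⇒∣p∣≤∣q∣)
import Data.Nat as ℕ
open import Data.Nat
  using (ℕ; zero; suc; pred; _+_; _*_; _∸_; _≤_; _≰_; _<?_; _≤?_; z≤n; s≤s; ∣_-_∣; NonZero; >-nonZero; >-nonZero⁻¹)
open import Data.Nat.Divisibility using (_∣_)
open import Data.Nat.Properties hiding (_≟_; suc-injective)
open import Algebra.Properties.Semiring.Sum +-*-semiring
  using (sum; sum-syntax; ∑-comm; ∑-distrib-+; *-distribˡ-sum; *-distribʳ-sum; sum-cong-≗)
open import Data.Nat.Tactic.RingSolver using (solve-∀)
open import Data.Product using (Σ; _×_; _,_)
open import Data.Sum using (inj₁; inj₂)
open import Data.Vec using ([]; _∷_; lookup; tabulate)
open import Data.Vec.Properties using (lookup∘tabulate; lookup-zipWith; []=⇒lookup; lookup⇒[]=)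
open import Defs
open import Function using (_∘_; id; case_of_)
open import Relation.Binary.PropositionalEquality
open import Relation.Nullary using (Dec; yes; no; contradiction)
open import Relation.Nullary.Decidable using (⌊_⌋)

-- Counting with indicator sums

𝟙 : Bool → ℕ
𝟙 true  = 1
𝟙 false = 0

count : ∀ {k} → (Fin k → Bool) → ℕ
count {k} p = ∑[ i < k ] 𝟙 (p i)

∑-mono-≤ : ∀ {k} {f g : Fin k → ℕ} → (∀ i → f i ≤ g i) → sum f ≤ sum g
∑-mono-≤ {zero}  f≤g = z≤n
∑-mono-≤ {suc k} f≤g = +-mono-≤ (f≤g zero) (∑-mono-≤ (f≤g ∘ suc))

∑-const : ∀ k c → ∑[ i < k ] c ≡ k * c
∑-const zero    c = refl
∑-const (suc k) c = cong (c +_) (∑-const k c)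

count-false : ∀ {k} (p : Fin k → Bool) → (∀ i → p i ≡ false) → count p ≡ 0
count-false {k} p p≡false = trans (sum-cong-≗ (cong 𝟙 ∘ p≡false)) (trans (∑-const k 0) (*-zeroʳ k))

count-all : ∀ n → count {n} (λ _ → true) ≡ n
count-all n = trans (∑-const n 1) (*-identityʳ n)

count-unique : ∀ {k} (p : Fin k → Bool) {i} → p i ≡ true → (∀ j → p j ≡ true → j ≡ i) → count p ≡ 1
count-unique {suc k} p {zero} p0 unique rewrite p0 =
  cong suc (count-false (p ∘ suc) λ j → ¬-not λ pj → case unique (suc j) pj of λ ())
count-unique {suc k} p {suc i} pi unique rewrite ¬-not {p zero} (λ p0 → case unique zero p0 of λ ()) =
  count-unique (p ∘ suc) pi (λ j pj → suc-injective (unique (suc j) pj))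

count-∧ˡ : ∀ {k} a (q : Fin k → Bool) → count (λ i → a ∧ q i) ≡ 𝟙 a * count q
count-∧ˡ {k} true  q = sym (*-identityˡ (count q))
count-∧ˡ {k} false q = count-false {k} (λ _ → false) (λ _ → refl)

count-split : ∀ {k} (p q : Fin k → Bool) →
  count p ≡ count (λ i → p i ∧ q i) + count (λ i → p i ∧ not (q i))
count-split p q =
  trans (sum-cong-≗ (λ i → 𝟙-split (p i) (q i))) (∑-distrib-+ (λ i → 𝟙 (p i ∧ q i)) (λ i → 𝟙 (p i ∧ not (q i))))
  where
  𝟙-split : ∀ a b → 𝟙 a ≡ 𝟙 (a ∧ b) + 𝟙 (a ∧ not b)
  𝟙-split false _     = refl
  𝟙-split true  false = refl
  𝟙-split true  true  = refl

count-∧true : ∀ {k} (p : Fin k → Bool) → count (λ i → p i ∧ true) ≡ count p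
count-∧true p = sum-cong-≗ (cong 𝟙 ∘ ∧-identityʳ ∘ p)

𝟙*-cong : ∀ a {x y} → (a ≡ true → x ≡ y) → 𝟙 a * x ≡ 𝟙 a * y
𝟙*-cong true  x≡y = cong (_+ 0) (x≡y refl)
𝟙*-cong false _   = refl

witness : ∀ {P : Set} (P? : Dec P) → ⌊ P? ⌋ ≡ true → P
witness (yes p) _ = p

_≠ᵇ_ : ∀ {k} → Fin k → Fin k → Bool
u ≠ᵇ v = not ⌊ u ≟ v ⌋

≠ᵇ⇒≢ : ∀ {k} {u v : Fin k} → u ≠ᵇ v ≡ true → u ≢ v
≠ᵇ⇒≢ {u = u} {v} u≠v with u ≟ v
... | no u≢v = u≢v

≟-refl : ∀ {k} (u : Fin k) → ⌊ u ≟ u ⌋ ≡ true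
≟-refl u with u ≟ u
... | yes _   = refl
... | no u≢u = contradiction refl u≢u

count-remove : ∀ {k} (p : Fin k → Bool) {u} → p u ≡ true → count (λ v → p v ∧ u ≠ᵇ v) ≡ count p ∸ 1
count-remove p {u} pu = begin
  others                                      ≡⟨⟩
  1 + others ∸ 1                              ≡⟨ cong (λ c → c + others ∸ 1) (count-unique _ p∧u≡u p∧u≡v⇒v≡u) ⟨
  count (λ v → p v ∧ ⌊ u ≟ v ⌋) + others ∸ 1  ≡⟨ cong (_∸ 1) (count-split p (λ v → ⌊ u ≟ v ⌋)) ⟨
  count p ∸ 1                                 ∎
  where
  open ≡-Reasoning
  others : ℕ
  others = count (λ v → p v ∧ u ≠ᵇ v)
  p∧u≡u : p u ∧ ⌊ u ≟ u ⌋ ≡ true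
  p∧u≡u rewrite pu = ≟-refl u
  p∧u≡v⇒v≡u : ∀ v → p v ∧ ⌊ u ≟ v ⌋ ≡ true → v ≡ u
  p∧u≡v⇒v≡u v eq = sym (witness (u ≟ v) (∧-conicalʳ (p v) _ eq))

pairs : ∀ {n} → (Fin n → Bool) → (Fin n → Bool) → ℕ
pairs {n} α γ = ∑[ u < n ] count (λ v → α u ∧ (γ v ∧ u ≠ᵇ v))

pairs-⊆ : ∀ {n} (α γ : Fin n → Bool) → (∀ u → α u ≡ true → γ u ≡ true) →
  pairs α γ ≡ count α * (count γ ∸ 1)
pairs-⊆ {n} α γ α⊆γ = begin
  ∑[ u < n ] count (λ v → α u ∧ (γ v ∧ u ≠ᵇ v))   ≡⟨ sum-cong-≗ (λ u → count-∧ˡ (α u) (λ v → γ v ∧ u ≠ᵇ v)) ⟩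
  ∑[ u < n ] (𝟙 (α u) * count (λ v → γ v ∧ u ≠ᵇ v)) ≡⟨ sum-cong-≗ (λ u → 𝟙*-cong (α u) (count-remove γ {u} ∘ α⊆γ u)) ⟩
  ∑[ u < n ] (𝟙 (α u) * (count γ ∸ 1))            ≡⟨ *-distribʳ-sum (count γ ∸ 1) (𝟙 ∘ α) ⟨
  count α * (count γ ∸ 1)                          ∎
  where open ≡-Reasoning

∣p∣≡count : ∀ {n} (p : Subset n) → ∣ p ∣ ≡ count (lookup p)
∣p∣≡count []          = refl
∣p∣≡count (true ∷ p)  = cong suc (∣p∣≡count p)
∣p∣≡count (false ∷ p) = ∣p∣≡count p

∣tabulate∣≡count : ∀ {n} (f : Fin n → Bool) → ∣ tabulate f ∣ ≡ count f
∣tabulate∣≡count f = trans (∣p∣≡count (tabulate f)) (sum-cong-≗ (cong 𝟙 ∘ lookup∘tabulate f))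

∣p∩q∣≡count : ∀ {n} (p q : Subset n) → ∣ p ∩ q ∣ ≡ count (λ v → lookup p v ∧ lookup q v)
∣p∩q∣≡count p q = trans (∣p∣≡count (p ∩ q)) (sum-cong-≗ (λ v → cong 𝟙 (lookup-zipWith _∧_ v p q)))

∈-tabulate⁻ : ∀ {n} {f : Fin n → Bool} {i} → i ∈ tabulate f → f i ≡ true
∈-tabulate⁻ {f = f} {i} i∈ = trans (sym (lookup∘tabulate f i)) ([]=⇒lookup i∈)

-- Pairs of points inside the blocks of a Steiner system

module _ {C n m} (S : SteinerSystem C n m) where
  open SteinerSystem S

  inBlock : Fin m → Fin n → Bool
  inBlock j = lookup (block j)

  meet : (Fin n → Bool) → Fin m → ℕ
  meet α j = count (λ v → inBlock j v ∧ α v)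

  blocks-through-pair : ∀ {u v} → u ≢ v → count (λ j → inBlock j u ∧ inBlock j v) ≡ 1
  blocks-through-pair {u} {v} u≢v with cover u v u≢v
  ... | j , u∈j , v∈j = count-unique _ u,v∈j only-j
    where
    u,v∈j : inBlock j u ∧ inBlock j v ≡ true
    u,v∈j rewrite []=⇒lookup u∈j | []=⇒lookup v∈j = refl
    only-j : ∀ k → inBlock k u ∧ inBlock k v ≡ true → k ≡ j
    only-j k u,v∈k = unique u v u≢v k j
      (lookup⇒[]= u (block k) (∧-conicalˡ _ _ u,v∈k)) (lookup⇒[]= v (block k) (∧-conicalʳ _ _ u,v∈k))
      u∈j v∈j

  ∑-pairs-in-blocks : ∀ (α γ : Fin n → Bool) →
    ∑[ j < m ] pairs (λ v → inBlock j v ∧ α v) (λ v → inBlock j v ∧ γ v) ≡ pairs α γ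
  ∑-pairs-in-blocks α γ = begin
    ∑[ j < m ] ∑[ u < n ] ∑[ v < n ] pair j u v   ≡⟨ ∑-comm (λ j u → ∑[ v < n ] pair j u v) ⟩
    ∑[ u < n ] ∑[ j < m ] ∑[ v < n ] pair j u v   ≡⟨ sum-cong-≗ (λ u → ∑-comm (λ j v → pair j u v)) ⟩
    ∑[ u < n ] ∑[ v < n ] ∑[ j < m ] pair j u v   ≡⟨ sum-cong-≗ (λ u → sum-cong-≗ (λ v → pair-in-one-block u v)) ⟩
    pairs α γ                                     ∎
    where
    open ≡-Reasoning
    pair : Fin m → Fin n → Fin n → ℕ
    pair j u v = 𝟙 ((inBlock j u ∧ α u) ∧ ((inBlock j v ∧ γ v) ∧ u ≠ᵇ v))
    regroup : ∀ a b x y z → (a ∧ x) ∧ ((b ∧ y) ∧ z) ≡ (x ∧ (y ∧ z)) ∧ (a ∧ b)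
    regroup false _     _     _ _ = sym (∧-zeroʳ _)
    regroup true  _     false _ _ = refl
    regroup true  false true  _ _ = sym (∧-zeroʳ _)
    regroup true  true  true  _ _ = sym (∧-identityʳ _)
    pair-in-one-block : ∀ u v → ∑[ j < m ] pair j u v ≡ 𝟙 (α u ∧ (γ v ∧ u ≠ᵇ v))
    pair-in-one-block u v = begin
      ∑[ j < m ] pair j u v                        ≡⟨ sum-cong-≗ (cong 𝟙 ∘ regroup′) ⟩
      count (λ j → z ∧ (inBlock j u ∧ inBlock j v)) ≡⟨ count-∧ˡ z (λ j → inBlock j u ∧ inBlock j v) ⟩
      𝟙 z * count (λ j → inBlock j u ∧ inBlock j v) ≡⟨ 𝟙*-cong z (blocks-through-pair ∘ distinct) ⟩
      𝟙 z * 1                                       ≡⟨ *-identityʳ (𝟙 z) ⟩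
      𝟙 z                                           ∎
      where
      z : Bool
      z = α u ∧ (γ v ∧ u ≠ᵇ v)
      regroup′ : ∀ j → (inBlock j u ∧ α u) ∧ ((inBlock j v ∧ γ v) ∧ u ≠ᵇ v) ≡ z ∧ (inBlock j u ∧ inBlock j v)
      regroup′ j = regroup (inBlock j u) (inBlock j v) (α u) (γ v) (u ≠ᵇ v)
      distinct : z ≡ true → u ≢ v
      distinct = ≠ᵇ⇒≢ ∘ ∧-conicalʳ (γ v) _ ∘ ∧-conicalʳ (α u) _

  ∑-meet-pairs : ∀ (α γ : Fin n → Bool) → (∀ v → α v ≡ true → γ v ≡ true) →
    ∑[ j < m ] (meet α j * (meet γ j ∸ 1)) ≡ count α * (count γ ∸ 1)
  ∑-meet-pairs α γ α⊆γ = begin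
    ∑[ j < m ] (meet α j * (meet γ j ∸ 1))  ≡⟨ sum-cong-≗ (λ j → pairs-⊆ _ _ (restrict j)) ⟨
    ∑[ j < m ] pairs (λ v → inBlock j v ∧ α v) (λ v → inBlock j v ∧ γ v) ≡⟨ ∑-pairs-in-blocks α γ ⟩
    pairs α γ                                ≡⟨ pairs-⊆ α γ α⊆γ ⟩
    count α * (count γ ∸ 1)                  ∎
    where
    open ≡-Reasoning
    restrict : ∀ j v → inBlock j v ∧ α v ≡ true → inBlock j v ∧ γ v ≡ true
    restrict j v eq with inBlock j v
    ... | true  = α⊆γ v eq
    ... | false = eq

  meet-all : ∀ j → meet (λ _ → true) j ≡ C
  meet-all j = trans (count-∧true (inBlock j)) (trans (sym (∣p∣≡count (block j))) (block-size j))

  ∑-meet : ∀ α → sum (meet α) * (C ∸ 1) ≡ count α * (n ∸ 1)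
  ∑-meet α = begin
    sum (meet α) * (C ∸ 1)                           ≡⟨ *-distribʳ-sum (C ∸ 1) (meet α) ⟩
    ∑[ j < m ] (meet α j * (C ∸ 1))                  ≡⟨ sum-cong-≗ (λ j → cong (λ c → meet α j * (c ∸ 1)) (meet-all j)) ⟨
    ∑[ j < m ] (meet α j * (meet (λ _ → true) j ∸ 1)) ≡⟨ ∑-meet-pairs α (λ _ → true) (λ _ _ → refl) ⟩
    count α * (count {n} (λ _ → true) ∸ 1)           ≡⟨ cong (λ k → count α * (k ∸ 1)) (count-all n) ⟩
    count α * (n ∸ 1)                                ∎
    where open ≡-Reasoning

  block-count : m * (C * (C ∸ 1)) ≡ n * (n ∸ 1)
  block-count = begin
    m * (C * (C ∸ 1))                                          ≡⟨ ∑-const m (C * (C ∸ 1)) ⟨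
    ∑[ j < m ] (C * (C ∸ 1))                                   ≡⟨ sum-cong-≗ (λ j → cong (λ c → c * (c ∸ 1)) (meet-all j)) ⟨
    ∑[ j < m ] (meet all j * (meet all j ∸ 1))                 ≡⟨ ∑-meet-pairs all all (λ _ _ → refl) ⟩
    count all * (count all ∸ 1)                                ≡⟨ cong (λ k → k * (k ∸ 1)) (count-all n) ⟩
    n * (n ∸ 1)                                                ∎
    where
    open ≡-Reasoning
    all : Fin n → Bool
    all _ = true

-- Second moment of the block intersections of one class

markov : ∀ {k} (p : Fin k → Bool) (f : Fin k → ℕ) {c} → (∀ i → p i ≡ true → c ≤ f i) → c * count p ≤ sum f
markov {k} p f {c} p⇒c≤f = begin
  c * count p              ≡⟨ *-distribˡ-sum c (𝟙 ∘ p) ⟩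
  ∑[ i < k ] (c * 𝟙 (p i)) ≤⟨ ∑-mono-≤ bound ⟩
  sum f                    ∎
  where
  open ≤-Reasoning
  bound : ∀ i → c * 𝟙 (p i) ≤ f i
  bound i with p i in pi
  ... | true  = ≤-trans (≤-reflexive (*-identityʳ c)) (p⇒c≤f i pi)
  ... | false = ≤-trans (≤-reflexive (*-zeroʳ c)) z≤n

m≤n⇒∣m-n∣²+2mn≡m²+n² : ∀ {m n} → m ≤ n → ∣ m - n ∣ * ∣ m - n ∣ + 2 * (m * n) ≡ m * m + n * n
m≤n⇒∣m-n∣²+2mn≡m²+n² {m} m≤n with m≤n⇒∃[o]m+o≡n m≤n
... | k , refl rewrite ∣m-m+n∣≡n m k = ring m k
  where
  ring : ∀ m k → k * k + 2 * (m * (m + k)) ≡ m * m + (m + k) * (m + k)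
  ring = solve-∀

∣m-n∣²+2mn≡m²+n² : ∀ m n → ∣ m - n ∣ * ∣ m - n ∣ + 2 * (m * n) ≡ m * m + n * n
∣m-n∣²+2mn≡m²+n² m n with ≤-total m n
... | inj₁ m≤n = m≤n⇒∣m-n∣²+2mn≡m²+n² m≤n
... | inj₂ n≤m = trans (cong₂ (λ d p → d * d + 2 * p) (∣-∣-comm m n) (*-comm m n))
  (trans (m≤n⇒∣m-n∣²+2mn≡m²+n² n≤m) (+-comm (n * n) (m * m)))

2m≤n⇒n≤2∣m-n∣ : ∀ {m n} → 2 * m ≤ n → n ≤ 2 * ∣ m - n ∣
2m≤n⇒n≤2∣m-n∣ {m} 2m≤n with m≤n⇒∃[o]m+o≡n (≤-trans (m≤m+n m (m + 0)) 2m≤n)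
... | k , refl rewrite ∣m-m+n∣≡n m k | +-identityʳ k =
  +-monoˡ-≤ k (≤-trans (≤-reflexive (sym (+-identityʳ m))) (+-cancelˡ-≤ m (m + 0) k 2m≤n))

n²≡n[n∸1]+n : ∀ n → n * n ≡ n * (n ∸ 1) + n
n²≡n[n∸1]+n zero    = refl
n²≡n[n∸1]+n (suc n) = ring n
  where
  ring : ∀ n → suc n * suc n ≡ suc n * n + suc n
  ring = solve-∀

∑-squared-deviation : ∀ {m} (x : Fin m → ℕ) a b →
  ∑[ j < m ] (∣ a * x j - b ∣ * ∣ a * x j - b ∣) + 2 * a * b * sum x
    ≡ a * a * (∑[ j < m ] (x j * (x j ∸ 1)) + sum x) + m * (b * b)
∑-squared-deviation {m} x a b = begin
  ∑[ j < m ] (d j * d j) + 2 * a * b * sum x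
    ≡⟨ cong (∑[ j < m ] (d j * d j) +_) (trans (*-distribˡ-sum (2 * a * b) x) (sum-cong-≗ (regroup-2ab a b ∘ x))) ⟩
  ∑[ j < m ] (d j * d j) + ∑[ j < m ] (2 * (a * x j * b))
    ≡⟨ ∑-distrib-+ (λ j → d j * d j) (λ j → 2 * (a * x j * b)) ⟨
  ∑[ j < m ] (d j * d j + 2 * (a * x j * b))
    ≡⟨ sum-cong-≗ (λ j → ∣m-n∣²+2mn≡m²+n² (a * x j) b) ⟩
  ∑[ j < m ] (a * x j * (a * x j) + b * b)
    ≡⟨ sum-cong-≗ (λ j → cong (_+ b * b) (trans (regroup-a² a (x j)) (cong (a * a *_) (n²≡n[n∸1]+n (x j))))) ⟩
  ∑[ j < m ] (a * a * (x j * (x j ∸ 1) + x j) + b * b)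
    ≡⟨ ∑-distrib-+ (λ j → a * a * (x j * (x j ∸ 1) + x j)) (λ _ → b * b) ⟩
  ∑[ j < m ] (a * a * (x j * (x j ∸ 1) + x j)) + ∑[ j < m ] (b * b)
    ≡⟨ cong₂ _+_ (*-distribˡ-sum (a * a) (λ j → x j * (x j ∸ 1) + x j)) (sym (∑-const m (b * b))) ⟨
  a * a * ∑[ j < m ] (x j * (x j ∸ 1) + x j) + m * (b * b)
    ≡⟨ cong (λ y → a * a * y + m * (b * b)) (∑-distrib-+ (λ j → x j * (x j ∸ 1)) x) ⟩
  a * a * (∑[ j < m ] (x j * (x j ∸ 1)) + sum x) + m * (b * b) ∎
  where
  open ≡-Reasoning
  d : Fin m → ℕ
  d j = ∣ a * x j - b ∣
  regroup-2ab : ∀ a b y → 2 * a * b * y ≡ 2 * (a * y * b)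
  regroup-2ab = solve-∀
  regroup-a² : ∀ a y → a * y * (a * y) ≡ a * a * (y * y)
  regroup-a² = solve-∀

n[C-1][s-1]≤[n-1]Cs : ∀ {c n₁} s → c ≤ n₁ → suc n₁ * c * (s ∸ 1) ≤ n₁ * suc c * s
n[C-1][s-1]≤[n-1]Cs {c} {n₁} zero    _    = ≤-trans (≤-reflexive (*-zeroʳ (suc n₁ * c))) z≤n
n[C-1][s-1]≤[n-1]Cs {c}      (suc s₁) c≤n₁ with m≤n⇒∃[o]m+o≡n c≤n₁
... | e , refl = ≤-trans (m≤m+n _ _) (≤-reflexive (ring c e s₁))
  where
  ring : ∀ c e s₁ → suc (c + e) * c * s₁ + ((c + e) * suc c + e * s₁) ≡ (c + e) * suc c * suc s₁
  ring = solve-∀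

-- With D the sum of squares, (C - 1) D = n² (C - 1) s (s - 1) + n² s (n - 1) - n (n - 1) s² C,
-- and the first term is at most the last because n (C - 1) (s - 1) ≤ (n - 1) C s.
variance-bound : ∀ {m} (x : Fin m → ℕ) {n s C} →
  ∑[ j < m ] (x j * (x j ∸ 1)) ≡ s * (s ∸ 1) →
  sum x * (C ∸ 1) ≡ s * (n ∸ 1) →
  m * (C * (C ∸ 1)) ≡ n * (n ∸ 1) →
  C ≤ n →
  (C ∸ 1) * ∑[ j < m ] (∣ n * x j - s * C ∣ * ∣ n * x j - s * C ∣) ≤ n * n * s * (n ∸ 1)
variance-bound x {C = zero} _ _ _ _ = z≤n
variance-bound {m} x {suc n₁} {s} {suc c} ∑x[x-1] ∑x*c m*C*c (s≤s c≤n₁) =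
  +-cancelʳ-≤ (2 * Q) (c * D) (n * n * s * n₁) (begin
    c * D + 2 * Q                                        ≡⟨ ring₁ c D n n₁ s C ⟩
    c * D + 2 * n * (s * C) * (s * n₁)                   ≡⟨ cong (λ y → c * D + 2 * n * (s * C) * y) ∑x*c ⟨
    c * D + 2 * n * (s * C) * (X * c)                    ≡⟨ ring₂ c D n s C X ⟩
    c * (D + 2 * n * (s * C) * X)                        ≡⟨ cong (c *_) (∑-squared-deviation x n (s * C)) ⟩
    c * (n * n * (P + X) + m * (s * C * (s * C)))        ≡⟨ ring₃ c n P X m s C ⟩
    n * n * c * P + n * n * (X * c) + m * (C * c) * (s * s * C)
      ≡⟨ cong₂ (λ y z → n * n * c * y + n * n * z + m * (C * c) * (s * s * C)) ∑x[x-1] ∑x*c ⟩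
    A + B + m * (C * c) * (s * s * C)                    ≡⟨ cong (λ y → A + B + y * (s * s * C)) m*C*c ⟩
    A + B + Q                                            ≤⟨ +-monoˡ-≤ Q (+-monoˡ-≤ B A≤Q) ⟩
    Q + B + Q                                            ≡⟨ ring₄ Q B ⟩
    B + 2 * Q                                            ≡⟨ cong (_+ 2 * Q) (*-assoc (n * n) s n₁) ⟨
    n * n * s * n₁ + 2 * Q                               ∎)
  where
  open ≤-Reasoning
  n : ℕ
  n = suc n₁
  C : ℕ
  C = suc c
  X : ℕ
  X = sum x
  P : ℕ
  P = ∑[ j < m ] (x j * (x j ∸ 1))
  D : ℕ
  D = ∑[ j < m ] (∣ n * x j - s * C ∣ * ∣ n * x j - s * C ∣)
  A : ℕ
  A = n * n * c * (s * (s ∸ 1))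
  B : ℕ
  B = n * n * (s * n₁)
  Q : ℕ
  Q = n * n₁ * (s * s * C)
  A≤Q : A ≤ Q
  A≤Q = begin
    A                                  ≡⟨ ring n c s (s ∸ 1) ⟩
    n * s * (n * c * (s ∸ 1))          ≤⟨ *-monoʳ-≤ (n * s) (n[C-1][s-1]≤[n-1]Cs s c≤n₁) ⟩
    n * s * (n₁ * C * s)               ≡⟨ ring′ n n₁ C s ⟩
    Q                                  ∎
    where
    ring : ∀ n c s s₁ → n * n * c * (s * s₁) ≡ n * s * (n * c * s₁)
    ring = solve-∀
    ring′ : ∀ n n₁ C s → n * s * (n₁ * C * s) ≡ n * n₁ * (s * s * C)
    ring′ = solve-∀
  ring₁ : ∀ c D n n₁ s C → c * D + 2 * (n * n₁ * (s * s * C)) ≡ c * D + 2 * n * (s * C) * (s * n₁)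
  ring₁ = solve-∀
  ring₂ : ∀ c D n s C X → c * D + 2 * n * (s * C) * (X * c) ≡ c * (D + 2 * n * (s * C) * X)
  ring₂ = solve-∀
  ring₃ : ∀ c n P X m s C → c * (n * n * (P + X) + m * (s * C * (s * C))) ≡
          n * n * c * P + n * n * (X * c) + m * (C * c) * (s * s * C)
  ring₃ = solve-∀
  ring₄ : ∀ Q B → Q + B + Q ≡ B + 2 * Q
  ring₄ = solve-∀

small-meet⇒far-from-mean : ∀ {n s C t y} .{{_ : NonZero t}} → n ≤ 2 * t * s → 100 * t * y ℕ.< C →
  s * C ≤ 2 * ∣ n * y - s * C ∣
small-meet⇒far-from-mean {n} {s} {C} {t} {y} n≤2ts 100ty<C = 2m≤n⇒n≤2∣m-n∣ {n * y} (*-cancelˡ-≤ 2 (begin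
  2 * (2 * (n * y))   ≡⟨ *-assoc 2 2 (n * y) ⟨
  4 * (n * y)         ≤⟨ *-monoˡ-≤ (n * y) (s≤s (s≤s (s≤s (s≤s (z≤n {96}))))) ⟩
  100 * (n * y)       ≤⟨ *-cancelˡ-≤ t (begin
    t * (100 * (n * y))   ≡⟨ ring₁ t n y ⟩
    n * (100 * t * y)     ≤⟨ *-monoʳ-≤ n (<⇒≤ 100ty<C) ⟩
    n * C                 ≤⟨ *-monoˡ-≤ C n≤2ts ⟩
    2 * t * s * C         ≡⟨ ring₂ t s C ⟩
    t * (2 * (s * C))     ∎) ⟩
  2 * (s * C)         ∎))
  where
  open ≤-Reasoning
  ring₁ : ∀ t n y → t * (100 * (n * y)) ≡ n * (100 * t * y)
  ring₁ = solve-∀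
  ring₂ : ∀ t s C → 2 * t * s * C ≡ t * (2 * (s * C))
  ring₂ = solve-∀

large-sum⇒large-summand : ∀ T {x y z C} → x ≡ y + z → C ≤ 100 * T * x → C ≰ 200 * T * y → C ≤ 200 * T * z
large-sum⇒large-summand T {x} {y} {z} {C} x≡y+z C≤100Tx C≰200Ty = ≮⇒≥ λ 200Tz<C → <-irrefl refl (begin-strict
  C + C                      ≡⟨ cong (C +_) (+-identityʳ C) ⟨
  2 * C                      ≤⟨ *-monoʳ-≤ 2 C≤100Tx ⟩
  2 * (100 * T * x)          ≡⟨ cong (λ x → 2 * (100 * T * x)) x≡y+z ⟩
  2 * (100 * T * (y + z))    ≡⟨ ring T y z ⟩
  200 * T * y + 200 * T * z  <⟨ +-mono-< (≰⇒> C≰200Ty) 200Tz<C ⟩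
  C + C                      ∎)
  where
  open ≤-Reasoning
  ring : ∀ T y z → 2 * (100 * T * (y + z)) ≡ 200 * T * y + 200 * T * z
  ring = solve-∀

16≤16K²t : ∀ k t .{{_ : NonZero t}} → 16 ≤ 16 * suc k * suc k * t
16≤16K²t k t = ≤-trans (m≤m*n 16 (suc k)) (≤-trans (m≤m*n (16 * suc k) (suc k)) (m≤m*n (16 * suc k * suc k) t))

chebyshev-count : ∀ {m} (x : Fin m → ℕ) {n s C t} .{{_ : NonZero t}} → n ≤ 2 * t * s →
  s * C * (s * C) * count (λ j → ⌊ 100 * t * x j <? C ⌋)
    ≤ 4 * ∑[ j < m ] (∣ n * x j - s * C ∣ * ∣ n * x j - s * C ∣)
chebyshev-count {m} x {n} {s} {C} {t} n≤2ts =
  ≤-trans (markov (λ j → ⌊ 100 * t * x j <? C ⌋) (λ j → 4 * (d j * d j)) far)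
          (≤-reflexive (sym (*-distribˡ-sum 4 (λ j → d j * d j))))
  where
  d : Fin m → ℕ
  d j = ∣ n * x j - s * C ∣
  far : ∀ j → ⌊ 100 * t * x j <? C ⌋ ≡ true → s * C * (s * C) ≤ 4 * (d j * d j)
  far j small = ≤-trans (*-mono-≤ sC≤2d sC≤2d) (≤-reflexive (ring (d j)))
    where
    sC≤2d : s * C ≤ 2 * d j
    sC≤2d = small-meet⇒far-from-mean n≤2ts (witness (100 * t * x j <? C) small)
    ring : ∀ d → 2 * d * (2 * d) ≡ 4 * (d * d)
    ring = solve-∀

few-low-by-variance : ∀ {L D m n s C t} k .{{_ : NonZero n}} .{{_ : NonZero s}} .{{_ : NonZero (C ∸ 1)}}
  .{{_ : NonZero t}} →
  s * C * (s * C) * L ≤ 4 * D →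
  (C ∸ 1) * D ≤ n * n * s * (n ∸ 1) →
  m * (C * (C ∸ 1)) ≡ n * (n ∸ 1) →
  16 * suc k * suc k * t ≤ C → n ≤ 2 * t * s →
  2 * suc k * suc k * L ≤ m
few-low-by-variance {L} {D} {m} {n} {s} {suc c} {t} k L[sC]²≤4D cD≤n²s[n-1] m*C*c≡n[n-1] 16K²t≤C n≤2ts =
  *-cancelʳ-≤ (2 * K * K * L) m (8 * t) {{m*n≢0 8 t}} (begin
    2 * K * K * L * (8 * t)  ≡⟨ ring₁ K L t ⟩
    16 * K * K * t * L       ≤⟨ *-monoˡ-≤ L 16K²t≤C ⟩
    C * L                    ≡⟨ *-comm C L ⟩
    L * C                    ≤⟨ LC≤8tm ⟩
    8 * t * m                ≡⟨ *-comm (8 * t) m ⟩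
    m * (8 * t)              ∎)
  where
  open ≤-Reasoning
  ring₁ : ∀ K L t → 2 * K * K * L * (8 * t) ≡ 16 * K * K * t * L
  ring₁ = solve-∀
  ring₂ : ∀ L s C c → L * s * C * (s * C * c) ≡ c * (s * C * (s * C) * L)
  ring₂ = solve-∀
  ring₃ : ∀ c D → c * (4 * D) ≡ 4 * (c * D)
  ring₃ = solve-∀
  ring₄ : ∀ n s n₁ → 4 * (n * n * s * n₁) ≡ 4 * n * s * (n * n₁)
  ring₄ = solve-∀
  ring₅ : ∀ n s m C c → 4 * n * s * (m * (C * c)) ≡ 4 * n * m * (s * C * c)
  ring₅ = solve-∀
  ring₆ : ∀ L C t s → L * C * (2 * t * s) ≡ 2 * t * (L * s * C)
  ring₆ = solve-∀
  ring₇ : ∀ t n m → 2 * t * (4 * n * m) ≡ 8 * t * m * n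
  ring₇ = solve-∀
  K : ℕ
  K = suc k
  C : ℕ
  C = suc c
  n₁ : ℕ
  n₁ = n ∸ 1
  LsC≤4nm : L * s * C ≤ 4 * n * m
  LsC≤4nm = *-cancelʳ-≤ (L * s * C) (4 * n * m) (s * C * c) {{m*n≢0 (s * C) c {{m*n≢0 s C}}}} (begin
    L * s * C * (s * C * c)    ≡⟨ ring₂ L s C c ⟩
    c * (s * C * (s * C) * L)  ≤⟨ *-monoʳ-≤ c L[sC]²≤4D ⟩
    c * (4 * D)                ≡⟨ ring₃ c D ⟩
    4 * (c * D)                ≤⟨ *-monoʳ-≤ 4 cD≤n²s[n-1] ⟩
    4 * (n * n * s * n₁)       ≡⟨ ring₄ n s n₁ ⟩
    4 * n * s * (n * n₁)       ≡⟨ cong (4 * n * s *_) m*C*c≡n[n-1] ⟨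
    4 * n * s * (m * (C * c))  ≡⟨ ring₅ n s m C c ⟩
    4 * n * m * (s * C * c)    ∎)
  LC≤8tm : L * C ≤ 8 * t * m
  LC≤8tm = *-cancelʳ-≤ (L * C) (8 * t * m) n (begin
    L * C * n            ≤⟨ *-monoʳ-≤ (L * C) n≤2ts ⟩
    L * C * (2 * t * s)  ≡⟨ ring₆ L C t s ⟩
    2 * t * (L * s * C)  ≤⟨ *-monoʳ-≤ (2 * t) LsC≤4nm ⟩
    2 * t * (4 * n * m)  ≡⟨ ring₇ t n m ⟩
    8 * t * m * n        ∎)

few-small-meets : ∀ {m} (x : Fin m → ℕ) {n s C t} k .{{_ : NonZero t}} →
  ∑[ j < m ] (x j * (x j ∸ 1)) ≡ s * (s ∸ 1) →
  sum x * (C ∸ 1) ≡ s * (n ∸ 1) →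
  m * (C * (C ∸ 1)) ≡ n * (n ∸ 1) →
  16 * suc k * suc k * t ≤ C → C ≤ n → n ≤ 2 * t * s →
  2 * suc k * suc k * count (λ j → ⌊ 100 * t * x j <? C ⌋) ≤ m
few-small-meets x {n} {s} {C} {t} k ∑x[x-1] ∑x*c m*C*c 16K²t≤C C≤n n≤2ts =
  few-low-by-variance k {{n≢0}} {{s≢0}} {{c≢0}} (chebyshev-count x n≤2ts)
    (variance-bound x ∑x[x-1] ∑x*c m*C*c C≤n) m*C*c 16K²t≤C n≤2ts
  where
  16≤C : 16 ≤ C
  16≤C = ≤-trans (16≤16K²t k t) 16K²t≤C
  c≢0 : NonZero (C ∸ 1)
  c≢0 = >-nonZero (≤-trans (s≤s z≤n) (∸-monoˡ-≤ 1 16≤C))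
  n≢0 : NonZero n
  n≢0 = >-nonZero (≤-trans (≤-trans (s≤s z≤n) 16≤C) C≤n)
  s≢0 : NonZero s
  s≢0 = m*n≢0⇒n≢0 (2 * t) {{>-nonZero (≤-trans (>-nonZero⁻¹ n {{n≢0}}) n≤2ts)}}

-- Blocks against the classes of an equipartition

inClass : ∀ {n t} → (Fin n → Fin t) → Fin t → Fin n → Bool
inClass part i v = ⌊ part v ≟ i ⌋

∑-count-classes : ∀ {n t} (part : Fin n → Fin t) (p : Fin n → Bool) →
  ∑[ i < t ] count (λ v → p v ∧ inClass part i v) ≡ count p
∑-count-classes {n} {t} part p = begin
  ∑[ i < t ] ∑[ v < n ] 𝟙 (p v ∧ inClass part i v)     ≡⟨ ∑-comm (λ i v → 𝟙 (p v ∧ inClass part i v)) ⟩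
  ∑[ v < n ] count (λ i → p v ∧ inClass part i v)     ≡⟨ sum-cong-≗ (λ v → count-∧ˡ (p v) (λ i → inClass part i v)) ⟩
  ∑[ v < n ] (𝟙 (p v) * count (λ i → inClass part i v)) ≡⟨ sum-cong-≗ (λ v → cong (𝟙 (p v) *_) (one-class v)) ⟩
  ∑[ v < n ] (𝟙 (p v) * 1)                            ≡⟨ sum-cong-≗ (λ v → *-identityʳ (𝟙 (p v))) ⟩
  count p                                             ∎
  where
  open ≡-Reasoning
  one-class : ∀ v → count (λ i → inClass part i v) ≡ 1
  one-class v = count-unique _ (≟-refl (part v)) (λ i → sym ∘ witness (part v ≟ i))

class-large : ∀ {n t} (part : Fin n → Fin t) → IsEquipartition part → 2 * t ≤ n →
  ∀ i → n ≤ 2 * t * count (inClass part i)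
class-large {n} {t} part equi 2t≤n i = +-cancelʳ-≤ n n (2 * t * s) (begin
  n + n                      ≤⟨ +-mono-≤ n≤t[1+s] n≤t[1+s] ⟩
  t * suc s + t * suc s      ≡⟨ ring t s ⟩
  2 * t * s + 2 * t          ≤⟨ +-monoʳ-≤ (2 * t * s) 2t≤n ⟩
  2 * t * s + n              ∎)
  where
  open ≤-Reasoning
  size : Fin t → ℕ
  size j = count (inClass part j)
  s : ℕ
  s = size i
  n≤t[1+s] : n ≤ t * suc s
  n≤t[1+s] = begin
    n                   ≡⟨ count-all n ⟨
    count {n} (λ _ → true) ≡⟨ ∑-count-classes part (λ _ → true) ⟨
    ∑[ j < t ] size j   ≤⟨ ∑-mono-≤ size≤1+s ⟩
    ∑[ j < t ] suc s    ≡⟨ ∑-const t (suc s) ⟩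
    t * suc s           ∎
    where
    size≤1+s : ∀ j → size j ≤ suc s
    size≤1+s j = subst₂ (λ a b → a ≤ suc b)
      (∣tabulate∣≡count (inClass part j)) (∣tabulate∣≡count (inClass part i)) (equi j i)
  ring : ∀ t s → t * suc s + t * suc s ≡ 2 * t * s + 2 * t
  ring = solve-∀

module LowMeets {C n m t} (S : SteinerSystem C n m) (part : Fin n → Fin t) .{{_ : NonZero t}}
         (equi : IsEquipartition part) (k : ℕ) (16K²t≤C : 16 * suc k * suc k * t ≤ C) (C≤n : C ≤ n)
  where
  open SteinerSystem S

  K : ℕ
  K = suc k

  instance
    C≢0 : NonZero C
    C≢0 = >-nonZero (≤-trans (s≤s z≤n) (≤-trans (16≤16K²t k t) 16K²t≤C))

  low : Fin t → Fin m → Bool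
  low i j = ⌊ 100 * t * meet S (inClass part i) j <? C ⌋

  few-low-blocks : ∀ i → 2 * K * K * count (low i) ≤ m
  few-low-blocks i = few-small-meets (meet S class) k (∑-meet-pairs S class class (λ _ → id)) (∑-meet S class)
    (block-count S) 16K²t≤C C≤n (class-large part equi 2t≤n i)
    where
    class : Fin n → Bool
    class = inClass part i
    2t≤n : 2 * t ≤ n
    2t≤n = ≤-trans (*-monoˡ-≤ t (≤-trans (s≤s (s≤s z≤n)) (≤-trans (m≤m*n 16 K) (m≤m*n (16 * K) K))))
                   (≤-trans 16K²t≤C C≤n)

  lows : Fin m → ℕ
  lows j = count (λ i → low i j)

  inℬ : Fin m → Bool
  inℬ j = ⌊ 2 * K * lows j ≤? t ⌋

  most-blocks-in-ℬ : K * count (not ∘ inℬ) ≤ m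
  most-blocks-in-ℬ = *-cancelʳ-≤ (K * count (not ∘ inℬ)) m t (begin
    K * count (not ∘ inℬ) * t            ≡⟨ ring K (count (not ∘ inℬ)) t ⟩
    K * (t * count (not ∘ inℬ))          ≤⟨ *-monoʳ-≤ K (markov (not ∘ inℬ) (λ j → 2 * K * lows j) outside) ⟩
    K * ∑[ j < m ] (2 * K * lows j)      ≡⟨ cong (K *_) (*-distribˡ-sum (2 * K) lows) ⟨
    K * (2 * K * sum lows)               ≡⟨ cong (λ x → K * (2 * K * x)) (∑-comm (λ j i → 𝟙 (low i j))) ⟩
    K * (2 * K * ∑[ i < t ] count (low i)) ≡⟨ ring′ K (∑[ i < t ] count (low i)) ⟩
    2 * K * K * ∑[ i < t ] count (low i) ≡⟨ *-distribˡ-sum (2 * K * K) (count ∘ low) ⟩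
    ∑[ i < t ] (2 * K * K * count (low i)) ≤⟨ ∑-mono-≤ few-low-blocks ⟩
    ∑[ i < t ] m                          ≡⟨ ∑-const t m ⟩
    t * m                                 ≡⟨ *-comm t m ⟩
    m * t                                 ∎)
    where
    open ≤-Reasoning
    outside : ∀ j → not (inℬ j) ≡ true → t ≤ 2 * K * lows j
    outside j j∉ℬ with 2 * K * lows j ≤? t
    ... | no t<2Klows = <⇒≤ (≰⇒> t<2Klows)
    ring : ∀ K x t → K * x * t ≡ K * (t * x)
    ring = solve-∀
    ring′ : ∀ K x → K * (2 * K * x) ≡ 2 * K * K * x
    ring′ = solve-∀

  module BlockCores (B₀ : Fin m → Subset n) (B₀⊆block : ∀ j → B₀ j ⊆ block j)
           (rest-small : ∀ j → 400 * K * (C ∸ ∣ B₀ j ∣) ≤ C) where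

    inCore : Fin m → Fin n → Bool
    inCore j = lookup (B₀ j)

    inRest : Fin m → Fin n → Bool
    inRest j v = inBlock S j v ∧ not (inCore j v)

    coreMeet : Fin m → Fin t → ℕ
    coreMeet j i = count (λ v → inCore j v ∧ inClass part i v)

    restMeet : Fin m → Fin t → ℕ
    restMeet j i = count (λ v → inRest j v ∧ inClass part i v)

    good : Fin m → Fin t → Bool
    good j i = ⌊ C ≤? 200 * t * coreMeet j i ⌋

    heavy : Fin m → Fin t → Bool
    heavy j i = ⌊ C ≤? 200 * t * restMeet j i ⌋

    meet-split : ∀ j α → meet S α j ≡ count (λ v → inCore j v ∧ α v) + count (λ v → inRest j v ∧ α v)
    meet-split j α = trans (sum-cong-≗ split) (∑-distrib-+ (λ v → 𝟙 (inCore j v ∧ α v)) (λ v → 𝟙 (inRest j v ∧ α v)))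
      where
      split : ∀ v → 𝟙 (inBlock S j v ∧ α v) ≡ 𝟙 (inCore j v ∧ α v) + 𝟙 (inRest j v ∧ α v)
      split v with inCore j v in core
      ... | true rewrite []=⇒lookup (B₀⊆block j (lookup⇒[]= v (B₀ j) core)) = sym (+-identityʳ _)
      ... | false with inBlock S j v
      ...   | true  = refl
      ...   | false = refl

    count-rest : ∀ j → count (inRest j) ≡ C ∸ ∣ B₀ j ∣
    count-rest j = begin
      count (inRest j)                        ≡⟨ m+n∸m≡n ∣ B₀ j ∣ (count (inRest j)) ⟨
      ∣ B₀ j ∣ + count (inRest j) ∸ ∣ B₀ j ∣  ≡⟨ cong (_∸ ∣ B₀ j ∣) C≡core+rest ⟨
      C ∸ ∣ B₀ j ∣                            ∎
      where
      open ≡-Reasoning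
      C≡core+rest : C ≡ ∣ B₀ j ∣ + count (inRest j)
      C≡core+rest = trans (sym (meet-all S j)) (trans (meet-split j (λ _ → true))
        (cong₂ _+_ (trans (count-∧true (inCore j)) (sym (∣p∣≡count (B₀ j)))) (count-∧true (inRest j))))

    few-heavy : ∀ j → 2 * K * count (heavy j) ≤ t
    few-heavy j = *-cancelʳ-≤ (2 * K * count (heavy j)) t C (begin
      2 * K * count (heavy j) * C                ≡⟨ ring K (count (heavy j)) C ⟩
      2 * K * (C * count (heavy j))              ≤⟨ *-monoʳ-≤ (2 * K) (markov (heavy j) (λ i → 200 * t * restMeet j i) heavy⇒) ⟩
      2 * K * ∑[ i < t ] (200 * t * restMeet j i) ≡⟨ cong (2 * K *_) (*-distribˡ-sum (200 * t) (restMeet j)) ⟨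
      2 * K * (200 * t * sum (restMeet j))       ≡⟨ cong (λ r → 2 * K * (200 * t * r)) (∑-count-classes part (inRest j)) ⟩
      2 * K * (200 * t * count (inRest j))       ≡⟨ ring′ K t (count (inRest j)) ⟩
      t * (400 * K * count (inRest j))           ≡⟨ cong (λ r → t * (400 * K * r)) (count-rest j) ⟩
      t * (400 * K * (C ∸ ∣ B₀ j ∣))             ≤⟨ *-monoʳ-≤ t (rest-small j) ⟩
      t * C                                      ∎)
      where
      open ≤-Reasoning
      heavy⇒ : ∀ i → heavy j i ≡ true → C ≤ 200 * t * restMeet j i
      heavy⇒ i = witness (C ≤? 200 * t * restMeet j i)
      ring : ∀ K H C → 2 * K * H * C ≡ 2 * K * (C * H)
      ring = solve-∀
      ring′ : ∀ K t r → 2 * K * (200 * t * r) ≡ t * (400 * K * r)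
      ring′ = solve-∀

    bad⇒low-or-heavy : ∀ j i → 𝟙 (not (good j i)) ≤ 𝟙 (low i j) + 𝟙 (heavy j i)
    bad⇒low-or-heavy j i with C ≤? 200 * t * coreMeet j i | 100 * t * meet S (inClass part i) j <? C
    ... | yes _ | _     = z≤n
    ... | no _  | yes _ = s≤s z≤n
    ... | no C≰core | no C≮meet with C ≤? 200 * t * restMeet j i
    ...   | yes _     = s≤s z≤n
    ...   | no C≰rest =
      contradiction (large-sum⇒large-summand t (meet-split j (inClass part i)) (≮⇒≥ C≮meet) C≰core) C≰rest

    most-classes-good : ∀ j → inℬ j ≡ true → K * count (not ∘ good j) ≤ t
    most-classes-good j j∈ℬ = *-cancelˡ-≤ 2 (begin
      2 * (K * count (not ∘ good j))           ≡⟨ *-assoc 2 K (count (not ∘ good j)) ⟨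
      2 * K * count (not ∘ good j)             ≤⟨ *-monoʳ-≤ (2 * K) bad≤low+heavy ⟩
      2 * K * (lows j + count (heavy j))       ≡⟨ *-distribˡ-+ (2 * K) (lows j) (count (heavy j)) ⟩
      2 * K * lows j + 2 * K * count (heavy j) ≤⟨ +-mono-≤ (witness (2 * K * lows j ≤? t) j∈ℬ) (few-heavy j) ⟩
      t + t                                    ≡⟨ cong (t +_) (+-identityʳ t) ⟨
      2 * t                                    ∎)
      where
      open ≤-Reasoning
      bad≤low+heavy : count (not ∘ good j) ≤ lows j + count (heavy j)
      bad≤low+heavy = ≤-trans (∑-mono-≤ (bad⇒low-or-heavy j))
                              (≤-reflexive (∑-distrib-+ (λ i → 𝟙 (low i j)) (λ i → 𝟙 (heavy j i))))

    good⇒large : ∀ j i → good j i ≡ true → C ≤ 200 * t * ∣ B₀ j ∩ cls part i ∣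
    good⇒large j i good-ji =
      subst (λ x → C ≤ 200 * t * x) (sym ∣B₀∩V∣≡coreMeet) (witness (C ≤? 200 * t * coreMeet j i) good-ji)
      where
      ∣B₀∩V∣≡coreMeet : ∣ B₀ j ∩ cls part i ∣ ≡ coreMeet j i
      ∣B₀∩V∣≡coreMeet = trans (∣p∩q∣≡count (B₀ j) (cls part i))
        (sum-cong-≗ (λ v → cong (λ b → 𝟙 (inCore j v ∧ b)) (lookup∘tabulate (inClass part i) v)))

-- Rational bookkeeping

module _ where
  open import Data.Integer as ℤ using (+_; +[1+_]; +0; -[1+_])
  import Data.Integer.Properties as ℤ
  import Data.Nat.Coprimality as Coprimality
  open import Data.Rational
    using (ℚ; mkℚ; _/_; 0ℚ; 1ℚ; _-_; -_; _<_; 1/_; *≤*; NonNegative; Positive; positive)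
    renaming (_+_ to _+ℚ_; _*_ to _*ℚ_; _≤_ to _≤ℚ_)
  import Data.Rational.Properties as ℚ
  open import Data.Rational.Solver using (module +-*-Solver)

  ℕ→ℚ-mkℚ : ∀ k → ℕ→ℚ k ≡ mkℚ (+ k) 0 (Coprimality.sym (Coprimality.1-coprimeTo k))
  ℕ→ℚ-mkℚ k = ℚ.normalize-coprime (Coprimality.sym (Coprimality.1-coprimeTo k))

  ℕ→ℚ-+ : ∀ a b → ℕ→ℚ (a + b) ≡ ℕ→ℚ a +ℚ ℕ→ℚ b
  ℕ→ℚ-+ a b rewrite ℕ→ℚ-mkℚ a | ℕ→ℚ-mkℚ b =
    cong (_/ 1) (sym (cong₂ ℤ._+_ (ℤ.*-identityʳ (+ a)) (ℤ.*-identityʳ (+ b))))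

  ℕ→ℚ-* : ∀ a b → ℕ→ℚ (a * b) ≡ ℕ→ℚ a *ℚ ℕ→ℚ b
  ℕ→ℚ-* a b rewrite ℕ→ℚ-mkℚ a | ℕ→ℚ-mkℚ b = cong (_/ 1) (ℤ.pos-* a b)

  ℕ→ℚ-nonNeg : ∀ k → NonNegative (ℕ→ℚ k)
  ℕ→ℚ-nonNeg k rewrite ℕ→ℚ-mkℚ k = _

  ℕ→ℚ-pos : ∀ k → Positive (ℕ→ℚ (suc k))
  ℕ→ℚ-pos k rewrite ℕ→ℚ-mkℚ (suc k) = _

  ℕ→ℚ-mono-≤ : ∀ {a b} → a ≤ b → ℕ→ℚ a ≤ℚ ℕ→ℚ b
  ℕ→ℚ-mono-≤ {a} {b} a≤b rewrite ℕ→ℚ-mkℚ a | ℕ→ℚ-mkℚ b =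
    *≤* (ℤ.*-monoʳ-≤-nonNeg (+ 1) (ℤ.+≤+ a≤b))

  ℕ→ℚ-cancel-≤ : ∀ {a b} → ℕ→ℚ a ≤ℚ ℕ→ℚ b → a ≤ b
  ℕ→ℚ-cancel-≤ {a} {b} le rewrite ℕ→ℚ-mkℚ a | ℕ→ℚ-mkℚ b with le
  ... | *≤* h = ℤ.drop‿+≤+ (ℤ.*-cancelʳ-≤-pos (+ a) (+ b) (+ 1) h)

  unitFraction : ℕ → ℚ
  unitFraction d = (1/ ℕ→ℚ (suc d)) {{ℚ.pos⇒nonZero (ℕ→ℚ (suc d)) {{ℕ→ℚ-pos d}}}}

  unitFraction-pos : ∀ d → 0ℚ < unitFraction d
  unitFraction-pos d = ℚ.positive⁻¹ (unitFraction d) {{ℚ.1/pos⇒pos (ℕ→ℚ (suc d)) {{ℕ→ℚ-pos d}}}}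

  [1+d]*unitFraction≡1 : ∀ d → ℕ→ℚ (suc d) *ℚ unitFraction d ≡ 1ℚ
  [1+d]*unitFraction≡1 d = ℚ.*-inverseʳ (ℕ→ℚ (suc d)) {{ℚ.pos⇒nonZero (ℕ→ℚ (suc d)) {{ℕ→ℚ-pos d}}}}

  archimedean : ∀ β → 0ℚ < β → Σ ℕ λ k → 1ℚ ≤ℚ ℕ→ℚ (suc k) *ℚ β
  archimedean β@(mkℚ +[1+ p ] d _) _ = d , (begin
    1ℚ                             ≡⟨ [1+d]*unitFraction≡1 d ⟨
    ℕ→ℚ (suc d) *ℚ unitFraction d  ≤⟨ ℚ.*-monoˡ-≤-nonNeg (ℕ→ℚ (suc d)) {{ℕ→ℚ-nonNeg (suc d)}} 1/[1+d]≤β ⟩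
    ℕ→ℚ (suc d) *ℚ β               ∎)
    where
    open ℚ.≤-Reasoning
    1/[1+d]≤β : unitFraction d ≤ℚ β
    1/[1+d]≤β rewrite ℕ→ℚ-mkℚ (suc d) = *≤* (ℤ.*-monoʳ-≤-nonNeg (+ suc d) (ℤ.+≤+ (s≤s (z≤n {p}))))
  archimedean (mkℚ +0       _ _) 0<β with () ← positive 0<β
  archimedean (mkℚ -[1+ _ ] _ _) 0<β with () ← positive 0<β

  rest-of-fraction : ∀ d ρ {b r C} → ℕ→ℚ b ≡ (1ℚ - ρ) *ℚ ℕ→ℚ C → b + r ≡ C → ρ ≤ℚ unitFraction d →
    suc d * r ≤ C
  rest-of-fraction d ρ {b} {r} {C} b≡[1-ρ]C b+r≡C ρ≤1/[1+d] = ℕ→ℚ-cancel-≤ (begin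
    ℕ→ℚ (suc d * r)                           ≡⟨ ℕ→ℚ-* (suc d) r ⟩
    ℕ→ℚ (suc d) *ℚ ℕ→ℚ r                      ≡⟨ cong (ℕ→ℚ (suc d) *ℚ_) r≡ρC ⟩
    ℕ→ℚ (suc d) *ℚ (ρ *ℚ ℕ→ℚ C)               ≤⟨ ℚ.*-monoˡ-≤-nonNeg (ℕ→ℚ (suc d)) {{ℕ→ℚ-nonNeg (suc d)}}
                                                   (ℚ.*-monoʳ-≤-nonNeg (ℕ→ℚ C) {{ℕ→ℚ-nonNeg C}} ρ≤1/[1+d]) ⟩
    ℕ→ℚ (suc d) *ℚ (unitFraction d *ℚ ℕ→ℚ C)  ≡⟨ ℚ.*-assoc (ℕ→ℚ (suc d)) (unitFraction d) (ℕ→ℚ C) ⟨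
    ℕ→ℚ (suc d) *ℚ unitFraction d *ℚ ℕ→ℚ C    ≡⟨ cong (_*ℚ ℕ→ℚ C) ([1+d]*unitFraction≡1 d) ⟩
    1ℚ *ℚ ℕ→ℚ C                               ≡⟨ ℚ.*-identityˡ (ℕ→ℚ C) ⟩
    ℕ→ℚ C                                     ∎)
    where
    open ℚ.≤-Reasoning
    open +-*-Solver
    r≡ρC : ℕ→ℚ r ≡ ρ *ℚ ℕ→ℚ C
    r≡ρC = begin-equality
      ℕ→ℚ r                         ≡⟨ solve 2 (λ b r → r := (b :+ r) :- b) refl (ℕ→ℚ b) (ℕ→ℚ r) ⟩
      (ℕ→ℚ b +ℚ ℕ→ℚ r) - ℕ→ℚ b      ≡⟨ cong₂ _-_ (trans (sym (ℕ→ℚ-+ b r)) (cong ℕ→ℚ b+r≡C)) b≡[1-ρ]C ⟩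
      ℕ→ℚ C - (1ℚ - ρ) *ℚ ℕ→ℚ C     ≡⟨ solve 2 (λ ρ c → c :- (con 1ℚ :- ρ) :* c := ρ :* c) refl ρ (ℕ→ℚ C) ⟩
      ρ *ℚ ℕ→ℚ C                    ∎

  most-of : ∀ k {β} → 1ℚ ≤ℚ ℕ→ℚ (suc k) *ℚ β → ∀ a b → suc k * a ≤ a + b →
    (1ℚ - β) *ℚ ℕ→ℚ (a + b) ≤ℚ ℕ→ℚ b
  most-of k {β} 1≤Kβ a b Ka≤a+b = begin
    (1ℚ - β) *ℚ ℕ→ℚ (a + b)               ≡⟨ cong ((1ℚ - β) *ℚ_) (ℕ→ℚ-+ a b) ⟩
    (1ℚ - β) *ℚ (A +ℚ B)                  ≡⟨ solve 3 (λ β A B → (con 1ℚ :- β) :* (A :+ B) := B :+ (A :- β :* (A :+ B)))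
                                               refl β A B ⟩
    B +ℚ (A - β *ℚ (A +ℚ B))              ≤⟨ ℚ.+-monoʳ-≤ B (ℚ.+-monoˡ-≤ (- (β *ℚ (A +ℚ B))) A≤β[A+B]) ⟩
    B +ℚ (β *ℚ (A +ℚ B) - β *ℚ (A +ℚ B))  ≡⟨ solve 2 (λ B x → B :+ (x :- x) := B) refl B (β *ℚ (A +ℚ B)) ⟩
    B                                     ∎
    where
    open ℚ.≤-Reasoning
    open +-*-Solver
    K : ℚ
    K = ℕ→ℚ (suc k)
    A : ℚ
    A = ℕ→ℚ a
    B : ℚ
    B = ℕ→ℚ b
    A≤β[A+B] : A ≤ℚ β *ℚ (A +ℚ B)
    A≤β[A+B] = ℚ.*-cancelˡ-≤-pos K {{ℕ→ℚ-pos k}} (begin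
      K *ℚ A                ≡⟨ ℕ→ℚ-* (suc k) a ⟨
      ℕ→ℚ (suc k * a)       ≤⟨ ℕ→ℚ-mono-≤ Ka≤a+b ⟩
      ℕ→ℚ (a + b)           ≡⟨ ℕ→ℚ-+ a b ⟩
      A +ℚ B                ≡⟨ ℚ.*-identityˡ (A +ℚ B) ⟨
      1ℚ *ℚ (A +ℚ B)        ≤⟨ ℚ.*-monoʳ-≤-nonNeg (A +ℚ B) {{subst NonNegative (ℕ→ℚ-+ a b) (ℕ→ℚ-nonNeg (a + b))}} 1≤Kβ ⟩
      K *ℚ β *ℚ (A +ℚ B)    ≡⟨ ℚ.*-assoc K β (A +ℚ B) ⟩
      K *ℚ (β *ℚ (A +ℚ B))  ∎)

  most-of-tabulate : ∀ k {β} → 1ℚ ≤ℚ ℕ→ℚ (suc k) *ℚ β → ∀ {l} (p : Fin l → Bool) →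
    suc k * count (not ∘ p) ≤ l → (1ℚ - β) *ℚ ℕ→ℚ l ≤ℚ ℕ→ℚ ∣ tabulate p ∣
  most-of-tabulate k {β} 1≤Kβ {l} p K*bad≤l =
    subst₂ (λ a b → (1ℚ - β) *ℚ ℕ→ℚ a ≤ℚ ℕ→ℚ b) bad+good≡l (sym (∣tabulate∣≡count p))
      (most-of k 1≤Kβ (count (not ∘ p)) (count p) (subst (suc k * count (not ∘ p) ≤_) (sym bad+good≡l) K*bad≤l))
    where
    bad+good≡l : count (not ∘ p) + count p ≡ l
    bad+good≡l = trans (+-comm (count (not ∘ p)) (count p)) (trans (sym (count-split (λ _ → true) p)) (count-all l))

  lemma5p8 : Σ ℕ λ t₀ → (β : ℚ) → 0ℚ < β → β < 1ℚ →
      Σ ℚ λ ρ₀ → 0ℚ < ρ₀ × ((t : ℕ) → t₀ ≤ t → (ρ : ℚ) → 0ℚ < ρ → ρ ≤ℚ ρ₀ →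
      Σ ℕ λ C₀ → (C : ℕ) → C₀ ≤ C →
      Σ ℕ λ n₀ → (n : ℕ) → n₀ ≤ n → (C * (C ∸ 1)) ∣ (n ∸ 1) →
      (m : ℕ) (S : SteinerSystem C n m) →
      (B₀ : Fin m → Subset n) →
      (∀ j → B₀ j ⊆ SteinerSystem.block S j) →
      (∀ j → ℕ→ℚ ∣ B₀ j ∣ ≡ (1ℚ - ρ) *ℚ ℕ→ℚ C) →
      (part : Fin n → Fin t) → IsEquipartition part →
      Σ (Subset m) λ ℬ → ((1ℚ - β) *ℚ ℕ→ℚ m ≤ℚ ℕ→ℚ ∣ ℬ ∣) ×
        (∀ j → j ∈ ℬ → Σ (Subset t) λ G → ((1ℚ - β) *ℚ ℕ→ℚ t ≤ℚ ℕ→ℚ ∣ G ∣) ×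
          (∀ i → i ∈ G → C ≤ 200 * t * ∣ B₀ j ∩ cls part i ∣)))
  -- ρ₀ = 1 / (400 K).
  lemma5p8 = 1 , λ β 0<β _ → let (k , 1≤Kβ) = archimedean β 0<β in
    unitFraction (pred (400 * suc k)) , unitFraction-pos (pred (400 * suc k)) ,
    λ t 1≤t ρ _ ρ≤ρ₀ → 16 * suc k * suc k * t , λ C C₀≤C → C ,
    λ n C≤n _ m S B₀ B₀⊆block |B₀|≡[1-ρ]C part equi →
      let open SteinerSystem S
          rest-small : ∀ j → 400 * suc k * (C ∸ ∣ B₀ j ∣) ≤ C
          rest-small j = rest-of-fraction (pred (400 * suc k)) ρ (|B₀|≡[1-ρ]C j)
            (m+[n∸m]≡n (≤-trans (p⊆q⇒∣p∣≤∣q∣ (B₀⊆block j)) (≤-reflexive (block-size j)))) ρ≤ρ₀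
          open LowMeets S part {{>-nonZero 1≤t}} equi k C₀≤C C≤n
          open BlockCores B₀ B₀⊆block rest-small
      in tabulate inℬ , most-of-tabulate k 1≤Kβ inℬ most-blocks-in-ℬ ,
         λ j j∈ℬ → tabulate (good j) , most-of-tabulate k 1≤Kβ (good j) (most-classes-good j (∈-tabulate⁻ j∈ℬ)) ,
                   λ i i∈G → good⇒large j i (∈-tabulate⁻ i∈G)
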